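{- Every plane graph $G$ with minimum degree $5$ has a vertex that sees at most $7$ other vertices.
   Context: A plane graph is a (finite, simple) planar graph together with an embedding in the plane. In an embedded graph, two distinct vertices $v$ and $w$ are said to be visible (and $v$ sees $w$) if $v$ and $w$ appear on a common face, i.e. both lie on the boundary walk of some face. -}

module Defs where

open import Data.Nat using (ℕ; zero; suc; _+_; _*_; _≤_; _<_)
open import Data.Fin using (Fin)
open import Data.Product using (Σ; ∃; ∃-syntax; _×_; _,_)
open import Data.Sum using (_⊎_; inj₁; inj₂)
open import Data.List using (List; length)
open import Data.List.Membership.Propositional using (_∈_)
open import Relation.Binary.PropositionalEquality using (_≡_; _≢_)
open import Relation.Binary.Construct.Closure.ReflexiveTransitive using (Star)
open import Function.Definitions using (Injective)

iter : {A : Set} → (A → A) → ℕ → A → A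
iter g zero    a = a
iter g (suc i) a = g (iter g i a)

DartAdj : {n k : ℕ} → (Fin k → Fin n) → (Fin k → Fin k) → Fin n → Fin n → Set
DartAdj {n} {k} tail rev u v = ∃[ x ] (tail x ≡ u × tail (rev x) ≡ v)

-- A (simple) plane graph without isolated vertices, encoded combinatorially
-- (Heffter–Edmonds rotation system of each component + placement of the
-- components into faces).
record PlaneGraph : Set₁ where
  field
    -- vertices Fin n, darts (half-edges) Fin k; each edge = a pair {x , rev x}
    n k      : ℕ
    tail     : Fin k → Fin n
    rev      : Fin k → Fin k
    rev-invol : ∀ x → rev (rev x) ≡ x
    no-loop  : ∀ x → tail (rev x) ≢ tail x
    no-multi : ∀ x y → tail x ≡ tail y → tail (rev x) ≡ tail (rev y) → x ≡ y
    no-isolated : ∀ v → ∃[ x ] tail x ≡ v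
    -- rotation system: a permutation rot whose cycles are exactly the dart sets at vertices
    rot rot⁻¹ : Fin k → Fin k
    rot-inv₁  : ∀ x → rot (rot⁻¹ x) ≡ x
    rot-inv₂  : ∀ x → rot⁻¹ (rot x) ≡ x
    rot-tail  : ∀ x → tail (rot x) ≡ tail x
    rot-cycle : ∀ x y → tail x ≡ tail y → ∃[ i ] iter rot i x ≡ y
    -- facial walks: orbits of φ x = rot (rev x), labelled by Fin w
    w         : ℕ
    walk      : Fin k → Fin w
    walk-φ    : ∀ x → walk (rot (rev x)) ≡ walk x
    walk-orbit : ∀ x y → walk x ≡ walk y → ∃[ i ] iter (λ z → rot (rev z)) i x ≡ y
    walk-surj : ∀ j → ∃[ x ] walk x ≡ j
    c         : ℕ
    comp      : Fin n → Fin c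
    comp-edge : ∀ x → comp (tail (rev x)) ≡ comp (tail x)
    comp-conn : ∀ u v → comp u ≡ comp v → Star (DartAdj tail rev) u v
    comp-surj : ∀ i → ∃[ v ] comp v ≡ i
    -- every component is embedded in the sphere (genus 0):
    -- Σ_components (V - E + W) = 2c, i.e. 2(n + w) = 4c + k
    euler     : 2 * (n + w) ≡ 4 * c + k
    -- faces of the embedding, labelled by Fin f; each facial walk lies on exactly one face
    f         : ℕ
    face      : Fin w → Fin f
    face-surj : ∀ g → ∃[ j ] face j ≡ g
    -- the component–face incidence graph (one edge per facial walk) is a tree:
    -- connected, with (#nodes - 1) edges
    tree-conn : ∀ a b → Star (λ p q → ∃[ x ]
                  ((p ≡ inj₁ (comp (tail x)) × q ≡ inj₂ (face (walk x))) ⊎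
                   (q ≡ inj₁ (comp (tail x)) × p ≡ inj₂ (face (walk x))))) a b
    tree-count : w + 1 ≡ c + f

open PlaneGraph public

Sees : (G : PlaneGraph) → Fin (n G) → Fin (n G) → Set
Sees G v u = v ≢ u × ∃[ x ] ∃[ y ]
  (tail G x ≡ v × tail G y ≡ u × face G (walk G x) ≡ face G (walk G y))

DegAtLeast : (G : PlaneGraph) → ℕ → Fin (n G) → Set
DegAtLeast G d v = Σ (Fin d → Fin (k G)) λ e → Injective _≡_ _≡_ e × (∀ i → tail G (e i) ≡ v)

MinDegree5 : PlaneGraph → Set
MinDegree5 G = (∀ v → DegAtLeast G 5 v) × ∃[ v ] (¬D (DegAtLeast G 6 v))
  where
  open import Relation.Nullary using (¬_)
  ¬D : Set → Set
  ¬D A = ¬ A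

SeesAtMost : (G : PlaneGraph) → ℕ → Fin (n G) → Set
SeesAtMost G m v = ∃[ L ] (length L ≤ m × (∀ u → Sees G v u → u ∈ L))

{-# OPTIONS --safe #-}
module Submission where

-- Discharging.  Each dart, lying on a face of length ℓ, carries 60 units: faceShare ℓ go
-- to its face and the remaining 20 + excess ℓ to its tail vertex.  A face of length ℓ ≥ 3
-- collects at least 120, while Euler's formula gives k < 2(n + f), i.e. 60k < 120(n + f);
-- so some vertex v collects less than 120.  Each of its at least five darts gives at least
-- 20, so v has degree exactly 5 and its excesses sum to less than 20: all faces at v are
-- triangles except at most one, of length 4 or 5.  A face of length at most 5 is a single
-- facial walk, so v sees its five neighbours and at most two further vertices of that face.

open import Defs
open import Data.Bool using (if_then_else_)
open import Data.Empty using (⊥-elim)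
open import Data.Fin using (Fin; zero; suc; inject≤)
open import Data.Fin.Properties using (_≟_; inject≤-injective; any?; all?; ¬∀⟶∃¬)
open import Data.List using (List; []; _∷_; _++_; _∷ʳ_; length; map; applyUpTo; tabulate)
open import Data.List.Membership.Propositional using (_∈_; _∉_)
open import Data.List.Membership.Propositional.Properties
  using (∈-map⁺; ∈-map⁻; ∈-applyUpTo⁺; ∈-applyUpTo⁻; ∈-++⁺ˡ; ∈-++⁺ʳ)
open import Data.List.Properties using (map-cong-local; map-applyUpTo; applyUpTo-∷ʳ; length-applyUpTo; length-++)
open import Data.List.Relation.Unary.All as All using (All; []; _∷_)
open import Data.List.Relation.Unary.All.Properties using (¬Any⇒All¬; applyUpTo⁺₁; tabulate⁺; ++⁺)
open import Data.List.Relation.Unary.Any using (here; there)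
open import Data.List.Relation.Unary.Unique.Propositional using (Unique; []; _∷_)
import Data.List.Relation.Unary.Unique.Propositional.Properties as Unique
open import Data.Nat using (ℕ; zero; suc; _+_; _*_; _∸_; _≤_; _<_; z≤n; s≤s; _≤?_)
import Data.Nat.ListAction as List
open import Data.Nat.Properties hiding (_≟_)
open import Data.Nat.Properties using () renaming (_≟_ to _≟ℕ_)
open import Data.Nat.Tactic.RingSolver using (solve-∀)
open import Data.Product using (∃-syntax; _×_; _,_; proj₁; proj₂)
open import Data.Sum using (_⊎_; inj₁; inj₂)
open import Relation.Nullary using (does; yes; no; ¬_)
open import Relation.Nullary.Decidable using (_×-dec_; ¬?)
open import Relation.Binary.PropositionalEquality
open import Algebra.Properties.Semiring.Sum +-*-semiring
  using (sum; sum-syntax; ∑-comm; ∑-distrib-+; sum-cong-≗; sum-replicate-zero; *-distribˡ-sum)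

δ : ∀ {m} → Fin m → Fin m → ℕ → ℕ
δ a b c = if does (a ≟ b) then c else 0

δ-refl : ∀ {m} (a : Fin m) c → δ a a c ≡ c
δ-refl a c with a ≟ a
... | yes _ = refl
... | no a≢a = ⊥-elim (a≢a refl)

∑-const : ∀ k c → ∑[ i < k ] c ≡ k * c
∑-const zero c = refl
∑-const (suc k) c = cong (c +_) (∑-const k c)

∑-mono-≤ : ∀ {k} {g h : Fin k → ℕ} → (∀ i → g i ≤ h i) → sum g ≤ sum h
∑-mono-≤ {zero} g≤h = z≤n
∑-mono-≤ {suc k} g≤h = +-mono-≤ (g≤h zero) (∑-mono-≤ (λ i → g≤h (suc i)))

∑-δ : ∀ {k} (a : Fin k) (h : Fin k → ℕ) → ∑[ b < k ] δ a b (h b) ≡ h a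
∑-δ {suc k} zero h = trans (cong (h zero +_) (sum-replicate-zero k)) (+-identityʳ (h zero))
∑-δ {suc k} (suc a) h = ∑-δ a (λ b → h (suc b))

sum-map-cong : ∀ {A : Set} {g h : A → ℕ} {xs} → All (λ x → g x ≡ h x) xs →
               List.sum (map g xs) ≡ List.sum (map h xs)
sum-map-cong g≡h = cong List.sum (map-cong-local g≡h)

-- ∑ h is h x plus the sum of h with x removed from its support.
sum-map≤∑ : ∀ {k} (h : Fin k → ℕ) {xs} → Unique xs → List.sum (map h xs) ≤ sum h
sum-map≤∑ h [] = z≤n
sum-map≤∑ {k} h {x ∷ xs} (x∉xs ∷ u) = begin
  h x + List.sum (map h xs)         ≡⟨ cong (h x +_) (sum-map-cong (All.map h≡h₋ x∉xs)) ⟩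
  h x + List.sum (map h₋ xs)        ≤⟨ +-monoʳ-≤ (h x) (sum-map≤∑ h₋ u) ⟩
  h x + sum h₋                      ≡⟨ cong (_+ sum h₋) (∑-δ x h) ⟨
  sum (λ y → δ x y (h y)) + sum h₋  ≡⟨ ∑-distrib-+ (λ y → δ x y (h y)) h₋ ⟨
  sum (λ y → δ x y (h y) + h₋ y)    ≡⟨ sum-cong-≗ split ⟩
  sum h                             ∎
  where
  open ≤-Reasoning
  h₋ : Fin k → ℕ
  h₋ y = if does (x ≟ y) then 0 else h y
  h≡h₋ : ∀ {y} → x ≢ y → h y ≡ h₋ y
  h≡h₋ {y} x≢y with x ≟ y
  ... | yes x≡y = ⊥-elim (x≢y x≡y)
  ... | no _ = refl
  split : ∀ y → δ x y (h y) + h₋ y ≡ h y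
  split y with x ≟ y
  ... | yes _ = +-identityʳ (h y)
  ... | no _ = refl

unique-∷ʳ⇒∉ : ∀ {A : Set} {x : A} xs → Unique (xs ∷ʳ x) → x ∉ xs
unique-∷ʳ⇒∉ (y ∷ ys) (y∉ ∷ u) (here refl) = All.lookup y∉ (∈-++⁺ʳ ys (here refl)) refl
unique-∷ʳ⇒∉ (y ∷ ys) (_ ∷ u) (there x∈ys) = unique-∷ʳ⇒∉ ys u x∈ys

module _ {k m : ℕ} (q : Fin k → Fin m) where

  open import Data.List.Membership.DecPropositional (_≟_ {k}) using (_∈?_)

  fibreSum : Fin m → (Fin k → ℕ) → ℕ
  fibreSum F h = ∑[ x < k ] δ (q x) F (h x)

  count : Fin m → ℕ
  count F = fibreSum F (λ _ → 1)

  ∑-fibres : ∀ h → ∑[ x < k ] h x ≡ ∑[ F < m ] fibreSum F h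
  ∑-fibres h = begin
    ∑[ x < k ] h x                           ≡⟨ sum-cong-≗ (λ x → ∑-δ (q x) (λ _ → h x)) ⟨
    ∑[ x < k ] ∑[ F < m ] δ (q x) F (h x)    ≡⟨ ∑-comm (λ x F → δ (q x) F (h x)) ⟩
    ∑[ F < m ] fibreSum F h                  ∎
    where open ≡-Reasoning

  fibreSum-+ : ∀ F g h → fibreSum F (λ x → g x + h x) ≡ fibreSum F g + fibreSum F h
  fibreSum-+ F g h = trans (sum-cong-≗ δ-+) (∑-distrib-+ (λ x → δ (q x) F (g x)) (λ x → δ (q x) F (h x)))
    where
    δ-+ : ∀ x → δ (q x) F (g x + h x) ≡ δ (q x) F (g x) + δ (q x) F (h x)
    δ-+ x with q x ≟ F
    ... | yes _ = refl
    ... | no _ = refl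

  fibreSum-const : ∀ F {h} c → (∀ x → q x ≡ F → h x ≡ c) → fibreSum F h ≡ c * count F
  fibreSum-const F {h} c h≡c = trans (sum-cong-≗ δ-h) (sym (*-distribˡ-sum c (λ x → δ (q x) F 1)))
    where
    δ-h : ∀ x → δ (q x) F (h x) ≡ c * δ (q x) F 1
    δ-h x with q x ≟ F
    ... | yes qx≡F = trans (h≡c x qx≡F) (sym (*-identityʳ c))
    ... | no _ = sym (*-zeroʳ c)

  sum-map≤fibreSum : ∀ F h {xs} → Unique xs → All (λ x → q x ≡ F) xs →
                     List.sum (map h xs) ≤ fibreSum F h
  sum-map≤fibreSum F h u inF =
    subst (_≤ fibreSum F h) (sum-map-cong (All.map δ-in inF))
          (sum-map≤∑ (λ x → δ (q x) F (h x)) u)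
    where
    δ-in : ∀ {x} → q x ≡ F → δ (q x) F (h x) ≡ h x
    δ-in {x} refl = δ-refl (q x) (h x)

  length≤count : ∀ F {xs} → Unique xs → All (λ x → q x ≡ F) xs → length xs ≤ count F
  length≤count F {xs} u inF = subst (_≤ count F) (sum-ones xs) (sum-map≤fibreSum F (λ _ → 1) u inF)
    where
    sum-ones : ∀ ys → List.sum (map (λ _ → 1) ys) ≡ length ys
    sum-ones [] = refl
    sum-ones (_ ∷ ys) = cong suc (sum-ones ys)

  fibre⊆unique : ∀ F {xs} → Unique xs → All (λ x → q x ≡ F) xs → count F ≤ length xs →
                 ∀ {y} → q y ≡ F → y ∈ xs
  fibre⊆unique F {xs} u inF count≤|xs| {y} qy≡F with y ∈? xs
  ... | yes y∈xs = y∈xs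
  ... | no y∉xs =
    ⊥-elim (<⇒≱ (length≤count F (¬Any⇒All¬ xs y∉xs ∷ u) (qy≡F ∷ inF)) count≤|xs|)

  count≤length : ∀ F xs → (∀ y → q y ≡ F → y ∈ xs) → count F ≤ length xs
  count≤length F xs fibre⊆xs = begin
    count F                                        ≤⟨ ∑-mono-≤ δ≤occurrences ⟩
    ∑[ y < k ] List.sum (map (λ a → δ a y 1) xs)   ≡⟨ ∑-occurrences xs ⟩
    length xs                                      ∎
    where
    open ≤-Reasoning
    ∑-occurrences : ∀ ys → ∑[ y < k ] List.sum (map (λ a → δ a y 1) ys) ≡ length ys
    ∑-occurrences [] = sum-replicate-zero k
    ∑-occurrences (a ∷ ys) = trans (∑-distrib-+ (λ y → δ a y 1) _)
                                   (cong₂ _+_ (∑-δ a (λ _ → 1)) (∑-occurrences ys))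
    occurs : ∀ {y ys} → y ∈ ys → 1 ≤ List.sum (map (λ a → δ a y 1) ys)
    occurs {y} (here refl) = ≤-trans (≤-reflexive (sym (δ-refl y 1))) (m≤m+n _ _)
    occurs {ys = a ∷ _} (there y∈ys) = ≤-trans (occurs y∈ys) (m≤n+m _ (δ a _ 1))
    δ≤occurrences : ∀ y → δ (q y) F 1 ≤ List.sum (map (λ a → δ a y 1) xs)
    δ≤occurrences y with q y ≟ F
    ... | yes qy≡F = occurs (fibre⊆xs y qy≡F)
    ... | no _ = z≤n

  fibre⊈ : ∀ F xs → length xs < count F → ∃[ y ] q y ≡ F × y ∉ xs
  fibre⊈ F xs length<count with any? (λ y → (q y ≟ F) ×-dec ¬? (y ∈? xs))
  ... | yes witness = witness
  ... | no none = ⊥-elim (<⇒≱ length<count (count≤length F xs fibre⊆xs))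
    where
    fibre⊆xs : ∀ y → q y ≡ F → y ∈ xs
    fibre⊆xs y qy≡F with y ∈? xs
    ... | yes y∈xs = y∈xs
    ... | no y∉xs = ⊥-elim (none (y , qy≡F , y∉xs))

k<2*[n+f] : (G : PlaneGraph) → k G < 2 * (n G + f G)
k<2*[n+f] G = subst (k G <_) (sym 2[n+f]≡k+2[c+1]) (m<m+n (k G) (s≤s z≤n))
  where
  open ≡-Reasoning
  2[n+f]≡k+2[c+1] : 2 * (n G + f G) ≡ k G + 2 * suc (c G)
  2[n+f]≡k+2[c+1] = +-cancelʳ-≡ (2 * c G) _ _ (begin
    2 * (n G + f G) + 2 * c G        ≡⟨ regroup (n G) (f G) (c G) ⟩
    2 * (n G + (c G + f G))          ≡⟨ cong (λ m → 2 * (n G + m)) (tree-count G) ⟨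
    2 * (n G + (w G + 1))            ≡⟨ shift (n G) (w G) ⟩
    2 * (n G + w G) + 2              ≡⟨ cong (_+ 2) (euler G) ⟩
    4 * c G + k G + 2                ≡⟨ reorder (c G) (k G) ⟩
    k G + 2 * suc (c G) + 2 * c G    ∎)
    where
    regroup : ∀ n f c → 2 * (n + f) + 2 * c ≡ 2 * (n + (c + f))
    regroup = solve-∀
    shift : ∀ n w → 2 * (n + (w + 1)) ≡ 2 * (n + w) + 2
    shift = solve-∀
    reorder : ∀ c k → 4 * c + k + 2 ≡ k + 2 * suc c + 2 * c
    reorder = solve-∀

DegAtLeast-weaken : ∀ {G d d′ v} → d ≤ d′ → DegAtLeast G d′ v → DegAtLeast G d v
DegAtLeast-weaken d≤d′ (e , e-injective , e-at) =
    (λ i → e (inject≤ i d≤d′))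
  , (λ eq → inject≤-injective d≤d′ d≤d′ _ _ (e-injective eq))
  , (λ i → e-at _)

module Faces (G : PlaneGraph) where

  open import Data.List.Membership.DecPropositional (_≟_ {k G}) using (_∈?_)

  Dart : Set
  Dart = Fin (k G)

  φ : Dart → Dart
  φ x = rot G (rev G x)

  head : Dart → Fin (n G)
  head x = tail G (rev G x)

  faceOf : Dart → Fin (f G)
  faceOf x = face G (walk G x)

  face-has-dart : ∀ F → ∃[ z ] faceOf z ≡ F
  face-has-dart F with face-surj G F
  ... | j , fj≡F with walk-surj G j
  ...   | z , wz≡j = z , trans (cong (face G) wz≡j) fj≡F

  faceLen : Dart → ℕ
  faceLen x = count faceOf (faceOf x)

  orbit : Dart → ℕ → List Dart
  orbit z m = applyUpTo (λ i → iter φ i z) m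

  rev-injective : ∀ {x y} → rev G x ≡ rev G y → x ≡ y
  rev-injective {x} {y} eq = trans (sym (rev-invol G x)) (trans (cong (rev G) eq) (rev-invol G y))

  φ-injective : ∀ {x y} → φ x ≡ φ y → x ≡ y
  φ-injective {x} {y} eq =
    rev-injective (trans (sym (rot-inv₂ G _)) (trans (cong (rot⁻¹ G) eq) (rot-inv₂ G _)))

  faceOf-φ : ∀ x → faceOf (φ x) ≡ faceOf x
  faceOf-φ x = cong (face G) (walk-φ G x)

  faceOf-iter : ∀ i x → faceOf (iter φ i x) ≡ faceOf x
  faceOf-iter zero x = refl
  faceOf-iter (suc i) x = trans (faceOf-φ (iter φ i x)) (faceOf-iter i x)

  tail-φ : ∀ x → tail G (φ x) ≡ head x
  tail-φ x = rot-tail G (rev G x)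

  tail-rot⁻¹ : ∀ x → tail G (rot⁻¹ G x) ≡ tail G x
  tail-rot⁻¹ x = trans (sym (rot-tail G (rot⁻¹ G x))) (cong (tail G) (rot-inv₁ G x))

  tail≡head-rot⁻¹ : ∀ {x z} → φ x ≡ z → tail G x ≡ head (rot⁻¹ G z)
  tail≡head-rot⁻¹ {x} refl = begin
    tail G x                          ≡⟨ cong (tail G) (rev-invol G x) ⟨
    tail G (rev G (rev G x))          ≡⟨ cong (λ y → tail G (rev G y)) (rot-inv₂ G (rev G x)) ⟨
    head (rot⁻¹ G (rot G (rev G x)))  ∎
    where open ≡-Reasoning

  φ-≢ : ∀ x → φ x ≢ x
  φ-≢ x eq = no-loop G x (trans (sym (tail-φ x)) (cong (tail G) eq))

  orbit-suc : ∀ z m → orbit z (suc m) ≡ z ∷ map φ (orbit z m)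
  orbit-suc z m = cong (z ∷_) (sym (map-applyUpTo (λ i → iter φ i z) φ m))

  orbit⊆face : ∀ z m → All (λ y → faceOf y ≡ faceOf z) (orbit z m)
  orbit⊆face z m = applyUpTo⁺₁ _ m (λ {i} _ → faceOf-iter i z)

  length≤faceLen : ∀ z {xs} → Unique xs → All (λ y → faceOf y ≡ faceOf z) xs → length xs ≤ faceLen z
  length≤faceLen z = length≤count faceOf (faceOf z)

  orbit-length≤faceLen : ∀ z m → Unique (orbit z m) → m ≤ faceLen z
  orbit-length≤faceLen z m u =
    subst (_≤ faceLen z) (length-applyUpTo _ m) (length≤faceLen z u (orbit⊆face z m))

  face⊆orbit : ∀ z → Unique (orbit z (faceLen z)) →
               ∀ {y} → faceOf y ≡ faceOf z → y ∈ orbit z (faceLen z)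
  face⊆orbit z u = fibre⊆unique faceOf (faceOf z) u (orbit⊆face z (faceLen z))
                     (≤-reflexive (sym (length-applyUpTo _ (faceLen z))))

  ∈-map-φ⁻ : ∀ {x xs} → φ x ∈ map φ xs → x ∈ xs
  ∈-map-φ⁻ φx∈ with ∈-map⁻ φ φx∈
  ... | y , y∈xs , φx≡φy = subst (_∈ _) (sym (φ-injective φx≡φy)) y∈xs

  orbit-grows : ∀ z m → Unique (orbit z m) → iter φ m z ∉ orbit z m → Unique (orbit z (suc m))
  orbit-grows z m u new = subst Unique (applyUpTo-∷ʳ _ m)
    (Unique.++⁺ u (All.[] ∷ []) (λ { (y∈ , here refl) → new y∈ }))

  orbit-closes : ∀ z m → Unique (orbit z (suc m)) →
                 iter φ (suc m) z ∈ orbit z (suc m) → iter φ (suc m) z ≡ z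
  orbit-closes z m u back with subst (iter φ (suc m) z ∈_) (orbit-suc z m) back
  ... | here eq = eq
  ... | there φ[φᵐz]∈ =
    ⊥-elim (unique-∷ʳ⇒∉ (orbit z m) (subst Unique (sym (applyUpTo-∷ʳ _ m)) u) (∈-map-φ⁻ φ[φᵐz]∈))

  rot-fixed⇒sole-dart : ∀ {x y} → rot G x ≡ x → tail G y ≡ tail G x → y ≡ x
  rot-fixed⇒sole-dart {x} {y} fixed ty≡tx with rot-cycle G x y (sym ty≡tx)
  ... | i , rotⁱx≡y = trans (sym rotⁱx≡y) (iter-fixed i)
    where
    iter-fixed : ∀ i → iter (rot G) i x ≡ x
    iter-fixed zero = refl
    iter-fixed (suc i) = trans (cong (rot G) (iter-fixed i)) fixed

  module MinDegree2 (deg≥2 : ∀ v → DegAtLeast G 2 v) where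

    rot-≢ : ∀ x → rot G x ≢ x
    rot-≢ x fixed with deg≥2 (tail G x)
    ... | e , e-injective , e-at with e-injective (trans (rot-fixed⇒sole-dart fixed (e-at zero))
                                                         (sym (rot-fixed⇒sole-dart fixed (e-at (suc zero)))))
    ...   | ()

    -- φ (φ x) ≡ x would make φ x and rev x parallel edges, so rot fixes rev x.
    φ²-≢ : ∀ x → φ (φ x) ≢ x
    φ²-≢ x φ²x≡x = rot-≢ (rev G x) (no-multi G (φ x) (rev G x) (tail-φ x) tail-rev-φx)
      where
      tail-rev-φx : tail G (rev G (φ x)) ≡ tail G (rev G (rev G x))
      tail-rev-φx = begin
        tail G (rev G (φ x))      ≡⟨ tail-φ (φ x) ⟨
        tail G (φ (φ x))          ≡⟨ cong (tail G) φ²x≡x ⟩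
        tail G x                  ≡⟨ cong (tail G) (rev-invol G x) ⟨
        tail G (rev G (rev G x))  ∎
        where open ≡-Reasoning

    orbit3-unique : ∀ z → Unique (orbit z 3)
    orbit3-unique z = (φ≢ z ∷ φ²≢ z ∷ []) ∷ (φ≢ (φ z) ∷ []) ∷ [] ∷ []
      where
      φ≢ : ∀ x → x ≢ φ x
      φ≢ x eq = φ-≢ x (sym eq)
      φ²≢ : ∀ x → x ≢ φ (φ x)
      φ²≢ x eq = φ²-≢ x (sym eq)

    3≤faceLen : ∀ z → 3 ≤ faceLen z
    3≤faceLen z = orbit-length≤faceLen z 3 (orbit3-unique z)

    period≥3 : ∀ z m → iter φ (suc m) z ≡ z → 2 ≤ m
    period≥3 z zero closes = ⊥-elim (φ-≢ z closes)
    period≥3 z (suc zero) closes = ⊥-elim (φ²-≢ z closes)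
    period≥3 z (suc (suc m)) closes = s≤s (s≤s z≤n)

    closed-orbit-preimage : ∀ z m → iter φ m z ≡ z → ∀ {y} → φ y ∈ orbit z m → y ∈ orbit z m
    closed-orbit-preimage z (suc m) closes {y} φy∈ with subst (φ y ∈_) (orbit-suc z m) φy∈
    ... | here φy≡z = subst (_∈ orbit z (suc m)) (sym (φ-injective (trans φy≡z (sym closes))))
                        (∈-applyUpTo⁺ (λ i → iter φ i z) (n<1+n m))
    ... | there φy∈φ[orbit] = subst (y ∈_) (applyUpTo-∷ʳ _ m) (∈-++⁺ˡ (∈-map-φ⁻ φy∈φ[orbit]))

    -- A closed orbit that misses part of its face leaves room for another orbit of at least 3 darts.
    closed-orbit-bound : ∀ z m → Unique (orbit z m) → iter φ m z ≡ z →
                         m < faceLen z → m + 3 ≤ faceLen z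
    closed-orbit-bound z m u closes m<faceLen
      with fibre⊈ faceOf (faceOf z) (orbit z m) (subst (_< faceLen z) (sym (length-applyUpTo _ m)) m<faceLen)
    ... | y , fy≡fz , y∉ = subst (_≤ faceLen z) length-both
          (length≤faceLen z (Unique.++⁺ u (orbit3-unique y) disjoint)
                        (++⁺ (orbit⊆face z m) (All.map (λ eq → trans eq fy≡fz) (orbit⊆face y 3))))
      where
      φy∉ : φ y ∉ orbit z m
      φy∉ φy∈ = y∉ (closed-orbit-preimage z m closes φy∈)
      disjoint : ∀ {x} → ¬ (x ∈ orbit z m × x ∈ orbit y 3)
      disjoint (x∈ , here refl) = y∉ x∈
      disjoint (x∈ , there (here refl)) = φy∉ x∈
      disjoint (x∈ , there (there (here refl))) = φy∉ (closed-orbit-preimage z m closes x∈)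
      length-both : length (orbit z m ++ orbit y 3) ≡ m + 3
      length-both = trans (length-++ (orbit z m)) (cong (_+ 3) (length-applyUpTo _ m))

    -- The orbit of z grows until φ returns to z, which by closed-orbit-bound cannot happen
    -- before the orbit fills a face of length at most 5.
    short-orbit : ∀ z → faceLen z ≤ 5 → Unique (orbit z (faceLen z)) × iter φ (faceLen z) z ≡ z
    short-orbit z faceLen≤5 = grow 5 0 faceLen≤5 ([] ∷ [])
      where
      grow : ∀ fuel m → faceLen z ≤ fuel + m → Unique (orbit z (suc m)) →
             Unique (orbit z (faceLen z)) × iter φ (faceLen z) z ≡ z
      grow zero m faceLen≤m u = ⊥-elim (<⇒≱ (orbit-length≤faceLen z (suc m) u) faceLen≤m)
      grow (suc fuel) m faceLen≤ u with iter φ (suc m) z ∈? orbit z (suc m)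
      ... | no new =
        grow fuel (suc m) (subst (faceLen z ≤_) (sym (+-suc fuel m)) faceLen≤) (orbit-grows z (suc m) u new)
      ... | yes back with orbit-closes z m u back
      ...   | closes with m≤n⇒m<n∨m≡n (orbit-length≤faceLen z (suc m) u)
      ...     | inj₂ m+1≡faceLen =
        subst (λ ℓ → Unique (orbit z ℓ) × iter φ ℓ z ≡ z) m+1≡faceLen (u , closes)
      ...     | inj₁ m+1<faceLen = ⊥-elim (<⇒≱ (s≤s (+-monoˡ-≤ 3 (period≥3 z m closes)))
                                          (≤-trans (closed-orbit-bound z (suc m) u closes m+1<faceLen) faceLen≤5))

    face-in-orbit : ∀ z → faceLen z ≤ 5 → ∀ {y} → faceOf y ≡ faceOf z → ∃[ i ] i < faceLen z × y ≡ iter φ i z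
    face-in-orbit z faceLen≤5 fy≡fz =
      ∈-applyUpTo⁻ (λ i → iter φ i z) (face⊆orbit z (proj₁ (short-orbit z faceLen≤5)) fy≡fz)

    tail-last : ∀ z → faceLen z ≤ 5 → ∀ {i} → suc i ≡ faceLen z → tail G (iter φ i z) ≡ head (rot⁻¹ G z)
    tail-last z faceLen≤5 i+1≡faceLen =
      tail≡head-rot⁻¹ (subst (λ ℓ → iter φ ℓ z ≡ z) (sym i+1≡faceLen) (proj₂ (short-orbit z faceLen≤5)))

    corner : Dart → List (Fin (n G)) → List (Fin (n G))
    corner z ws = tail G z ∷ head z ∷ head (rot⁻¹ G z) ∷ ws

    triangle-vertices : ∀ z → faceLen z ≡ 3 → ∀ {y} → faceOf y ≡ faceOf z → tail G y ∈ corner z []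
    triangle-vertices z faceLen≡3 {y} fy≡fz = vertex (face-in-orbit z faceLen≤5 fy≡fz)
      where
      faceLen≤5 : faceLen z ≤ 5
      faceLen≤5 = ≤-trans (≤-reflexive faceLen≡3) (m≤m+n 3 2)
      vertex : ∃[ i ] i < faceLen z × y ≡ iter φ i z → tail G y ∈ corner z []
      vertex (0 , _ , refl) = here refl
      vertex (1 , _ , refl) = there (here (tail-φ z))
      vertex (2 , _ , refl) = there (there (here (tail-last z faceLen≤5 (sym faceLen≡3))))
      vertex (suc (suc (suc i)) , i<faceLen , _) =
        ⊥-elim (<⇒≱ i<faceLen (≤-trans (≤-reflexive faceLen≡3) (m≤m+n 3 i)))

    short-face-vertices : ∀ z → faceLen z ≤ 5 → ∀ {y} → faceOf y ≡ faceOf z →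
                          tail G y ∈ corner z (tail G (iter φ 2 z) ∷ tail G (iter φ 3 z) ∷ [])
    short-face-vertices z faceLen≤5 {y} fy≡fz = vertex (face-in-orbit z faceLen≤5 fy≡fz)
      where
      vertex : ∃[ i ] i < faceLen z × y ≡ iter φ i z →
               tail G y ∈ corner z (tail G (iter φ 2 z) ∷ tail G (iter φ 3 z) ∷ [])
      vertex (0 , _ , refl) = here refl
      vertex (1 , _ , refl) = there (here (tail-φ z))
      vertex (2 , _ , refl) = there (there (there (here refl)))
      vertex (3 , _ , refl) = there (there (there (there (here refl))))
      vertex (4 , 4<faceLen , refl) = there (there (here (tail-last z faceLen≤5 (≤-antisym 4<faceLen faceLen≤5))))
      vertex (suc (suc (suc (suc (suc i)))) , i<faceLen , _) =
        ⊥-elim (<⇒≱ i<faceLen (≤-trans faceLen≤5 (m≤m+n 5 i)))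

    module _ {v : Fin (n G)} {ds : List Dart} (ds-complete : ∀ {x} → tail G x ≡ v → x ∈ ds) where

      sight : Dart → List (Fin (n G))
      sight a = map head ds ++ tail G (iter φ 2 a) ∷ tail G (iter φ 3 a) ∷ []

      neighbour∈sight : ∀ {a x} → tail G x ≡ v → head x ∈ sight a
      neighbour∈sight tx≡v = ∈-++⁺ˡ (∈-map⁺ head (ds-complete tx≡v))

      corner⊆sight : ∀ {a x w ws} → tail G x ≡ v → v ≢ w → (∀ {w′} → w′ ∈ ws → w′ ∈ sight a) →
                     w ∈ corner x ws → w ∈ sight a
      corner⊆sight tx≡v v≢w _ (here w≡tx) = ⊥-elim (v≢w (trans (sym tx≡v) (sym w≡tx)))
      corner⊆sight tx≡v _ _ (there (here refl)) = neighbour∈sight tx≡v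
      corner⊆sight {x = x} tx≡v _ _ (there (there (here refl))) =
        neighbour∈sight (trans (tail-rot⁻¹ x) tx≡v)
      corner⊆sight _ _ ws⊆sight (there (there (there w∈ws))) = ws⊆sight w∈ws

      sees⊆sight : ∀ a → faceLen a ≤ 5 → (∀ {x} → tail G x ≡ v → x ≢ a → faceLen x ≡ 3) →
                   ∀ {u} → Sees G v u → u ∈ sight a
      sees⊆sight a faceLen≤5 triangles (v≢u , x , y , tx≡v , refl , fx≡fy) with x ≟ a
      ... | yes refl =
        corner⊆sight tx≡v v≢u (∈-++⁺ʳ (map head ds)) (short-face-vertices x faceLen≤5 (sym fx≡fy))
      ... | no x≢a =
        corner⊆sight tx≡v v≢u (λ ()) (triangle-vertices x (triangles tx≡v x≢a) (sym fx≡fy))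

-- 120 / ℓ, capped at 20, so that every face of length ℓ ≥ 3 collects at least 120.
faceShare : ℕ → ℕ
faceShare 3 = 40
faceShare 4 = 30
faceShare 5 = 24
faceShare _ = 20

excess : ℕ → ℕ
excess ℓ = 40 ∸ faceShare ℓ

faceShare+vertexShare : ∀ ℓ → faceShare ℓ + (20 + excess ℓ) ≡ 60
faceShare+vertexShare 0 = refl
faceShare+vertexShare 1 = refl
faceShare+vertexShare 2 = refl
faceShare+vertexShare 3 = refl
faceShare+vertexShare 4 = refl
faceShare+vertexShare 5 = refl
faceShare+vertexShare (suc (suc (suc (suc (suc (suc ℓ)))))) = refl

120≤faceShare*ℓ : ∀ ℓ → 3 ≤ ℓ → 120 ≤ faceShare ℓ * ℓ
120≤faceShare*ℓ 1 (s≤s ())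
120≤faceShare*ℓ 2 (s≤s (s≤s ()))
120≤faceShare*ℓ 3 _ = ≤-refl
120≤faceShare*ℓ 4 _ = ≤-refl
120≤faceShare*ℓ 5 _ = ≤-refl
120≤faceShare*ℓ (suc (suc (suc (suc (suc (suc ℓ)))))) _ = *-monoʳ-≤ 20 (m≤m+n 6 ℓ)

excess<20⇒ℓ≤5 : ∀ ℓ → excess ℓ < 20 → ℓ ≤ 5
excess<20⇒ℓ≤5 0 _ = z≤n
excess<20⇒ℓ≤5 1 _ = s≤s z≤n
excess<20⇒ℓ≤5 2 _ = s≤s (s≤s z≤n)
excess<20⇒ℓ≤5 3 _ = s≤s (s≤s (s≤s z≤n))
excess<20⇒ℓ≤5 4 _ = s≤s (s≤s (s≤s (s≤s z≤n)))
excess<20⇒ℓ≤5 5 _ = ≤-refl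
excess<20⇒ℓ≤5 (suc (suc (suc (suc (suc (suc ℓ)))))) 20<20 = ⊥-elim (<-irrefl refl 20<20)

10≤excess : ∀ ℓ → ℓ ≢ 3 → 10 ≤ excess ℓ
10≤excess 3 ℓ≢3 = ⊥-elim (ℓ≢3 refl)
10≤excess 4 _ = ≤-refl
10≤excess 5 _ = m≤n+m 10 6
10≤excess 0 _ = m≤n+m 10 10
10≤excess 1 _ = m≤n+m 10 10
10≤excess 2 _ = m≤n+m 10 10
10≤excess (suc (suc (suc (suc (suc (suc ℓ)))))) _ = m≤n+m 10 10

module Discharging (G : PlaneGraph) (deg≥2 : ∀ v → DegAtLeast G 2 v) where

  open Faces G
  open MinDegree2 deg≥2

  vertexCharge : Fin (n G) → ℕ
  vertexCharge v = fibreSum (tail G) v (λ x → 20 + excess (faceLen x))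

  faceCharge : Fin (f G) → ℕ
  faceCharge F = fibreSum faceOf F (λ x → faceShare (faceLen x))

  total-charge : ∑[ F < f G ] faceCharge F + ∑[ v < n G ] vertexCharge v ≡ k G * 60
  total-charge = begin
    ∑[ F < f G ] faceCharge F + ∑[ v < n G ] vertexCharge v
      ≡⟨ cong₂ _+_ (∑-fibres faceOf _) (∑-fibres (tail G) _) ⟨
    ∑[ x < k G ] faceShare (faceLen x) + ∑[ x < k G ] (20 + excess (faceLen x))
      ≡⟨ ∑-distrib-+ (λ x → faceShare (faceLen x)) (λ x → 20 + excess (faceLen x)) ⟨
    ∑[ x < k G ] (faceShare (faceLen x) + (20 + excess (faceLen x)))
      ≡⟨ sum-cong-≗ (λ x → faceShare+vertexShare (faceLen x)) ⟩
    ∑[ x < k G ] 60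
      ≡⟨ ∑-const (k G) 60 ⟩
    k G * 60 ∎
    where open ≡-Reasoning

  faceCharge-faceOf : ∀ z → faceCharge (faceOf z) ≡ faceShare (faceLen z) * faceLen z
  faceCharge-faceOf z = fibreSum-const faceOf (faceOf z) (faceShare (faceLen z))
                          (λ _ fx≡fz → cong (λ F → faceShare (count faceOf F)) fx≡fz)

  120≤faceCharge : ∀ F → 120 ≤ faceCharge F
  120≤faceCharge F with face-has-dart F
  ... | z , refl = subst (120 ≤_) (sym (faceCharge-faceOf z)) (120≤faceShare*ℓ (faceLen z) (3≤faceLen z))

  light-vertex : ∃[ v ] vertexCharge v < 120
  light-vertex with all? (λ v → 120 ≤? vertexCharge v)
  ... | no ¬heavy with ¬∀⟶∃¬ (n G) _ (λ v → 120 ≤? vertexCharge v) ¬heavy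
  ...   | v , v-light = v , ≰⇒> v-light
  light-vertex | yes heavy = ⊥-elim (<⇒≱ (*-monoˡ-< 60 (k<2*[n+f] G)) (begin
    2 * (n G + f G) * 60                                       ≡⟨ spread (n G) (f G) ⟩
    f G * 120 + n G * 120
      ≡⟨ cong₂ _+_ (∑-const (f G) 120) (∑-const (n G) 120) ⟨
    ∑[ F < f G ] 120 + ∑[ v < n G ] 120
      ≤⟨ +-mono-≤ (∑-mono-≤ 120≤faceCharge) (∑-mono-≤ heavy) ⟩
    ∑[ F < f G ] faceCharge F + ∑[ v < n G ] vertexCharge v    ≡⟨ total-charge ⟩
    k G * 60                                                   ∎))
    where
    open ≤-Reasoning
    spread : ∀ n f → 2 * (n + f) * 60 ≡ f * 120 + n * 120
    spread = solve-∀

module LightVertex (G : PlaneGraph) (deg≥5 : ∀ v → DegAtLeast G 5 v) where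

  deg≥2 : ∀ v → DegAtLeast G 2 v
  deg≥2 v = DegAtLeast-weaken {G = G} (s≤s (s≤s z≤n)) (deg≥5 v)

  open Faces G
  open MinDegree2 deg≥2
  open Discharging G deg≥2

  module _ {v : Fin (n G)} (light : vertexCharge v < 120) where

    e : Fin 5 → Dart
    e = proj₁ (deg≥5 v)

    e-at-v : ∀ i → tail G (e i) ≡ v
    e-at-v = proj₂ (proj₂ (deg≥5 v))

    ds : List Dart
    ds = tabulate e

    ds-unique : Unique ds
    ds-unique = Unique.tabulate⁺ (proj₁ (proj₂ (deg≥5 v)))

    ds-at-v : All (λ x → tail G x ≡ v) ds
    ds-at-v = tabulate⁺ e-at-v

    excessAt : ℕ
    excessAt = fibreSum (tail G) v (λ x → excess (faceLen x))

    vertexCharge-split : vertexCharge v ≡ 20 * count (tail G) v + excessAt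
    vertexCharge-split = trans (fibreSum-+ (tail G) v (λ _ → 20) (λ x → excess (faceLen x)))
                               (cong (_+ excessAt) (fibreSum-const (tail G) v 20 (λ _ _ → refl)))

    light-split : 20 * count (tail G) v + excessAt < 120
    light-split = subst (_< 120) vertexCharge-split light

    5≤degree : 5 ≤ count (tail G) v
    5≤degree = length≤count (tail G) v ds-unique ds-at-v

    degree≤5 : count (tail G) v ≤ 5
    degree≤5 = ≤-pred (*-cancelˡ-< 20 _ 6 (≤-<-trans (m≤m+n _ excessAt) light-split))

    excessAt<20 : excessAt < 20
    excessAt<20 = +-cancelˡ-< 100 excessAt 20
      (≤-<-trans (+-monoˡ-≤ excessAt (*-monoʳ-≤ 20 5≤degree)) light-split)

    ds-complete : ∀ {x} → tail G x ≡ v → x ∈ ds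
    ds-complete = fibre⊆unique (tail G) v ds-unique ds-at-v degree≤5

    faceLen≤5 : ∀ {a} → tail G a ≡ v → faceLen a ≤ 5
    faceLen≤5 {a} ta≡v = excess<20⇒ℓ≤5 (faceLen a) (≤-<-trans excess≤excessAt excessAt<20)
      where
      excess≤excessAt : excess (faceLen a) ≤ excessAt
      excess≤excessAt = subst (_≤ excessAt) (+-identityʳ _)
        (sum-map≤fibreSum (tail G) v (λ x → excess (faceLen x)) ([] ∷ []) (ta≡v ∷ []))

    one-non-triangle : ∀ {a b} → a ≢ b → tail G a ≡ v → tail G b ≡ v → faceLen a ≡ 3 ⊎ faceLen b ≡ 3
    one-non-triangle {a} {b} a≢b ta≡v tb≡v with faceLen a ≟ℕ 3 | faceLen b ≟ℕ 3
    ... | yes a-triangle | _ = inj₁ a-triangle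
    ... | no _ | yes b-triangle = inj₂ b-triangle
    ... | no a-long | no b-long = ⊥-elim (<⇒≱ excessAt<20 (begin
      20                                  ≤⟨ +-mono-≤ (10≤excess _ a-long) (10≤excess _ b-long) ⟩
      excess (faceLen a) + excess (faceLen b)     ≡⟨ cong (excess (faceLen a) +_) (+-identityʳ _) ⟨
      List.sum (map (λ x → excess (faceLen x)) (a ∷ b ∷ []))
        ≤⟨ sum-map≤fibreSum (tail G) v _ ((a≢b ∷ []) ∷ [] ∷ []) (ta≡v ∷ tb≡v ∷ []) ⟩
      excessAt                            ∎))
      where open ≤-Reasoning

    all-triangles-but-one : ∃[ a ] tail G a ≡ v × (∀ {x} → tail G x ≡ v → x ≢ a → faceLen x ≡ 3)
    all-triangles-but-one with any? (λ x → (tail G x ≟ v) ×-dec ¬? (faceLen x ≟ℕ 3))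
    ... | yes (a , ta≡v , a-long) = a , ta≡v , triangles
      where
      triangles : ∀ {x} → tail G x ≡ v → x ≢ a → faceLen x ≡ 3
      triangles tx≡v x≢a with one-non-triangle x≢a tx≡v ta≡v
      ... | inj₁ x-triangle = x-triangle
      ... | inj₂ a-triangle = ⊥-elim (a-long a-triangle)
    ... | no no-long = e zero , e-at-v zero , triangles
      where
      triangles : ∀ {x} → tail G x ≡ v → x ≢ e zero → faceLen x ≡ 3
      triangles {x} tx≡v _ with faceLen x ≟ℕ 3
      ... | yes x-triangle = x-triangle
      ... | no x-long = ⊥-elim (no-long (x , tx≡v , x-long))

    seesAtMost7 : SeesAtMost G 7 v
    seesAtMost7 =
      let a , ta≡v , triangles = all-triangles-but-one
      in sight ds-complete a , ≤-refl , λ _ → sees⊆sight ds-complete a (faceLen≤5 ta≡v) triangles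

lemma5p4 : (G : PlaneGraph) → 0 < n G → MinDegree5 G → ∃[ v ] SeesAtMost G 7 v
lemma5p4 G _ (deg≥5 , _) =
  let v , light = Discharging.light-vertex G deg≥2 in v , seesAtMost7 light
  where open LightVertex G deg≥5
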